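{- Let $H=\begin{pmatrix}H_1\\H_2\end{pmatrix}$ be a Hadamard matrix of order $n$ (after a suitable permutation of its rows), where $H_1$ is an $\ell\times n$ matrix with $1\le \ell\le n$, and suppose that $H_1^\top H_1=\ell I_n+a(J_n-I_n)$ for some integer $a$. Then $(\ell,a)\in\{(1,1),(n-1,-1),(n,0)\}$.
   Context: A Hadamard matrix of order $n$ is an $n\times n$ matrix $H$ with entries in $\{1,-1\}$ such that $HH^\top=nI_n$. $I_n$ is the identity matrix and $J_n$ the all-ones matrix of order $n$. -}

module Defs where

open import Data.Nat as ℕ using (ℕ; zero; suc)
open import Data.Integer using (ℤ; +_; _+_; _*_; -_; _-_; 0ℤ; 1ℤ)
open import Data.Fin using (Fin; zero; suc; _≟_)
open import Data.Sum using (_⊎_)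
open import Data.Product using (_×_)
open import Relation.Nullary using (does)
open import Data.Bool using (if_then_else_)
open import Relation.Binary.PropositionalEquality using (_≡_)

Matrix : ℕ → ℕ → Set
Matrix m k = Fin m → Fin k → ℤ

sumFin : ∀ n → (Fin n → ℤ) → ℤ
sumFin zero    f = 0ℤ
sumFin (suc n) f = f zero + sumFin n (λ i → f (suc i))

infix 10 _ᵀ
_ᵀ : ∀ {m k} → Matrix m k → Matrix k m
(A ᵀ) i j = A j i

infixl 7 _⊗_
_⊗_ : ∀ {m k p} → Matrix m k → Matrix k p → Matrix m p
_⊗_ {k = k} A B i j = sumFin k (λ t → A i t * B t j)

infixl 6 _⊕_
_⊕_ : ∀ {m k} → Matrix m k → Matrix m k → Matrix m k
(A ⊕ B) i j = A i j + B i j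

_⊖_ : ∀ {m k} → Matrix m k → Matrix m k → Matrix m k
(A ⊖ B) i j = A i j - B i j

infixl 7 _·_
_·_ : ∀ {m k} → ℤ → Matrix m k → Matrix m k
(c · A) i j = c * A i j

I : ∀ n → Matrix n n
I n i j = if does (i ≟ j) then 1ℤ else 0ℤ

J : ∀ n → Matrix n n
J n i j = 1ℤ

infix 4 _≋_
_≋_ : ∀ {m k} → Matrix m k → Matrix m k → Set
A ≋ B = ∀ i j → A i j ≡ B i j

IsHadamard : ∀ n → Matrix n n → Set
IsHadamard n H = (∀ i j → (H i j ≡ 1ℤ) ⊎ (H i j ≡ - 1ℤ)) × (H ⊗ H ᵀ ≋ (+ n) · I n)

module Submission where

-- The rows of H are pairwise orthogonal of squared length n, so
-- H₁ H₁ᵀ = n I_ℓ, and therefore the Gram matrix G = H₁ᵀ H₁ satisfies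
--   G G = H₁ᵀ (H₁ H₁ᵀ) H₁ = n G.
-- By hypothesis G = ℓ I + a (J − I).  Reading the identity G G = n G at a
-- diagonal entry and at an off-diagonal entry (n = m + 2 ≥ 2) gives
--   ℓ² + (n−1) a² = n ℓ    and    2 ℓ a + (n−2) a² = n a.
-- Their difference is (ℓ − a)(ℓ − a − n) = 0.  If ℓ = a, the second equation
-- becomes n a (a − 1) = 0, and ℓ ≥ 1 forces (ℓ, a) = (1, 1); if ℓ = n + a,
-- it becomes n a (a + 1) = 0, giving (ℓ, a) = (n, 0) or (n − 1, −1).

open import Defs
open import Data.Nat using (ℕ; zero; suc; _≤_; _∸_; s≤s; z≤n)
open import Data.Integer using (ℤ; +_; -_; 0ℤ; 1ℤ; _+_; _*_; _-_)
open import Data.Integer.Properties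
  using (+-identityˡ; +-identityʳ; *-identityˡ; *-zeroˡ; *-zeroʳ; *-comm; *-assoc;
         *-distribˡ-+; +-injective; i≡j⇒i-j≡0; i-j≡0⇒i≡j; i*j≡0⇒i≡0∨j≡0)
open import Data.Integer.Tactic.RingSolver using (solve-∀)
open import Data.Fin using (Fin; zero; suc; inject≤; _≟_)
open import Data.Fin.Properties using (inject≤-injective)
open import Data.Fin.Permutation using (Permutation′; _⟨$⟩ʳ_; _⟨$⟩ˡ_; inverseˡ)
open import Data.Sum using (_⊎_; inj₁; inj₂)
open import Data.Product using (_×_; _,_; uncurry)
open import Data.Empty using (⊥-elim)
open import Function.Definitions using (Injective)
open import Relation.Nullary using (yes; no)
open import Relation.Binary.PropositionalEquality
  using (_≡_; _≢_; refl; sym; trans; cong; cong₂; module ≡-Reasoning)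
open ≡-Reasoning

sum-cong : ∀ n {f g : Fin n → ℤ} → (∀ i → f i ≡ g i) → sumFin n f ≡ sumFin n g
sum-cong zero    f≡g = refl
sum-cong (suc n) f≡g = cong₂ _+_ (f≡g zero) (sum-cong n (λ i → f≡g (suc i)))

sum-zero : ∀ n → sumFin n (λ _ → 0ℤ) ≡ 0ℤ
sum-zero zero    = refl
sum-zero (suc n) = trans (+-identityˡ _) (sum-zero n)

sum-const : ∀ n c → sumFin n (λ _ → c) ≡ + n * c
sum-const zero    c = sym (*-zeroˡ c)
sum-const (suc n) c = trans (cong (_+_ c) (sum-const n c)) (step (+ n) c)
  where
  step : ∀ x c → c + x * c ≡ (1ℤ + x) * c
  step = solve-∀

sum-+ : ∀ n (f g : Fin n → ℤ) → sumFin n (λ i → f i + g i) ≡ sumFin n f + sumFin n g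
sum-+ zero    f g = refl
sum-+ (suc n) f g =
  trans (cong (_+_ (f zero + g zero)) (sum-+ n _ _)) (interchange (f zero) (g zero) _ _)
  where
  interchange : ∀ a b c d → a + b + (c + d) ≡ a + c + (b + d)
  interchange = solve-∀

sum-*ˡ : ∀ n c (f : Fin n → ℤ) → sumFin n (λ i → c * f i) ≡ c * sumFin n f
sum-*ˡ zero    c f = sym (*-zeroʳ c)
sum-*ˡ (suc n) c f =
  trans (cong (_+_ (c * f zero)) (sum-*ˡ n c _)) (sym (*-distribˡ-+ c (f zero) _))

sum-*ʳ : ∀ n c (f : Fin n → ℤ) → sumFin n (λ i → f i * c) ≡ sumFin n f * c
sum-*ʳ n c f = begin
  sumFin n (λ i → f i * c) ≡⟨ sum-cong n (λ i → *-comm (f i) c) ⟩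
  sumFin n (λ i → c * f i) ≡⟨ sum-*ˡ n c f ⟩
  c * sumFin n f           ≡⟨ *-comm c _ ⟩
  sumFin n f * c           ∎

sum-swap : ∀ n m (f : Fin n → Fin m → ℤ) →
  sumFin n (λ i → sumFin m (f i)) ≡ sumFin m (λ j → sumFin n (λ i → f i j))
sum-swap zero    m f = sym (sum-zero m)
sum-swap (suc n) m f = begin
  sumFin m (f zero) + sumFin n (λ i → sumFin m (f (suc i)))
    ≡⟨ cong (_+_ (sumFin m (f zero))) (sum-swap n m (λ i → f (suc i))) ⟩
  sumFin m (f zero) + sumFin m (λ j → sumFin n (λ i → f (suc i) j))
    ≡⟨ sym (sum-+ m (f zero) _) ⟩
  sumFin m (λ j → f zero j + sumFin n (λ i → f (suc i) j)) ∎

I-diag : ∀ n (i : Fin n) → I n i i ≡ 1ℤ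
I-diag n i with i ≟ i
... | yes _  = refl
... | no i≢i = ⊥-elim (i≢i refl)

I-off : ∀ n {i j : Fin n} → i ≢ j → I n i j ≡ 0ℤ
I-off n {i} {j} i≢j with i ≟ j
... | yes i≡j = ⊥-elim (i≢j i≡j)
... | no _    = refl

sum-δ : ∀ n (i : Fin n) (f : Fin n → ℤ) → sumFin n (λ t → I n i t * f t) ≡ f i
sum-δ (suc n) zero f = begin
  1ℤ * f zero + sumFin n (λ t → 0ℤ * f (suc t))
    ≡⟨ cong₂ _+_ (*-identityˡ (f zero))
                 (trans (sum-cong n (λ t → *-zeroˡ (f (suc t)))) (sum-zero n)) ⟩
  f zero + 0ℤ ≡⟨ +-identityʳ _ ⟩
  f zero      ∎
sum-δ (suc n) (suc i) f = begin
  0ℤ * f zero + sumFin n (λ t → I n i t * f (suc t))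
    ≡⟨ cong₂ _+_ (*-zeroˡ (f zero)) (sum-δ n i (λ t → f (suc t))) ⟩
  0ℤ + f (suc i) ≡⟨ +-identityˡ _ ⟩
  f (suc i)      ∎

I-injective : ∀ {ℓ n} (p : Fin ℓ → Fin n) → Injective _≡_ _≡_ p →
  ∀ r s → I n (p r) (p s) ≡ I ℓ r s
I-injective {ℓ} {n} p p-inj r s with r ≟ s
... | yes refl = I-diag n (p r)
... | no r≢s   = I-off n (λ pr≡ps → r≢s (p-inj pr≡ps))

⊗-assoc : ∀ {m k p q} (A : Matrix m k) (B : Matrix k p) (C : Matrix p q) →
  (A ⊗ B) ⊗ C ≋ A ⊗ (B ⊗ C)
⊗-assoc {k = k} {p} A B C i j = begin
  sumFin p (λ u → sumFin k (λ t → A i t * B t u) * C u j)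
    ≡⟨ sum-cong p (λ u → sym (sum-*ʳ k (C u j) _)) ⟩
  sumFin p (λ u → sumFin k (λ t → A i t * B t u * C u j))
    ≡⟨ sym (sum-swap k p _) ⟩
  sumFin k (λ t → sumFin p (λ u → A i t * B t u * C u j))
    ≡⟨ sum-cong k (λ t → sum-cong p (λ u → *-assoc (A i t) (B t u) (C u j))) ⟩
  sumFin k (λ t → sumFin p (λ u → A i t * (B t u * C u j)))
    ≡⟨ sum-cong k (λ t → sum-*ˡ p (A i t) _) ⟩
  sumFin k (λ t → A i t * sumFin p (λ u → B t u * C u j)) ∎

⊗-congˡ : ∀ {m k p} {A A′ : Matrix m k} (B : Matrix k p) → A ≋ A′ → A ⊗ B ≋ A′ ⊗ B
⊗-congˡ {k = k} B A≋A′ i j = sum-cong k (λ t → cong (_* B t j) (A≋A′ i t))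

⊗-congʳ : ∀ {m k p} (A : Matrix m k) {B B′ : Matrix k p} → B ≋ B′ → A ⊗ B ≋ A ⊗ B′
⊗-congʳ {k = k} A B≋B′ i j = sum-cong k (λ t → cong (A i t *_) (B≋B′ t j))

scalar-I-⊗ : ∀ {n k} (c : ℤ) (A : Matrix n k) → (c · I n) ⊗ A ≋ c · A
scalar-I-⊗ {n} c A i j = begin
  sumFin n (λ t → c * I n i t * A t j)   ≡⟨ sum-cong n (λ t → *-assoc c (I n i t) (A t j)) ⟩
  sumFin n (λ t → c * (I n i t * A t j)) ≡⟨ sum-*ˡ n c _ ⟩
  c * sumFin n (λ t → I n i t * A t j)   ≡⟨ cong (c *_) (sum-δ n i (λ t → A t j)) ⟩
  c * A i j                              ∎

⊗-scalarʳ : ∀ {m k p} (A : Matrix m k) (c : ℤ) (B : Matrix k p) → A ⊗ (c · B) ≋ c · (A ⊗ B)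
⊗-scalarʳ {k = k} A c B i j = begin
  sumFin k (λ t → A i t * (c * B t j)) ≡⟨ sum-cong k (λ t → reorder (A i t) c (B t j)) ⟩
  sumFin k (λ t → c * (A i t * B t j)) ≡⟨ sum-*ˡ k c _ ⟩
  c * sumFin k (λ t → A i t * B t j)   ∎
  where
  reorder : ∀ x c y → x * (c * y) ≡ c * (x * y)
  reorder = solve-∀

gram-square : ∀ {ℓ n} (A : Matrix ℓ n) (c : ℤ) → A ⊗ A ᵀ ≋ c · I ℓ →
  (A ᵀ ⊗ A) ⊗ (A ᵀ ⊗ A) ≋ c · (A ᵀ ⊗ A)
gram-square A c AAᵀ≋cI i j = begin
  ((A ᵀ ⊗ A) ⊗ (A ᵀ ⊗ A)) i j ≡⟨ ⊗-assoc (A ᵀ) A (A ᵀ ⊗ A) i j ⟩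
  (A ᵀ ⊗ (A ⊗ (A ᵀ ⊗ A))) i j ≡⟨ ⊗-congʳ (A ᵀ) (λ r s → sym (⊗-assoc A (A ᵀ) A r s)) i j ⟩
  (A ᵀ ⊗ ((A ⊗ A ᵀ) ⊗ A)) i j ≡⟨ ⊗-congʳ (A ᵀ) (⊗-congˡ A AAᵀ≋cI) i j ⟩
  (A ᵀ ⊗ ((c · I _) ⊗ A)) i j ≡⟨ ⊗-congʳ (A ᵀ) (scalar-I-⊗ c A) i j ⟩
  (A ᵀ ⊗ (c · A)) i j         ≡⟨ ⊗-scalarʳ (A ᵀ) c A i j ⟩
  c * (A ᵀ ⊗ A) i j           ∎

square-law-cong : ∀ {n} {G B : Matrix n n} (c : ℤ) → G ≋ B → G ⊗ G ≋ c · G → B ⊗ B ≋ c · B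
square-law-cong {G = G} {B} c G≋B G²≋cG i j = begin
  (B ⊗ B) i j ≡⟨ ⊗-congˡ B (λ r s → sym (G≋B r s)) i j ⟩
  (G ⊗ B) i j ≡⟨ ⊗-congʳ G (λ r s → sym (G≋B r s)) i j ⟩
  (G ⊗ G) i j ≡⟨ G²≋cG i j ⟩
  c * G i j   ≡⟨ cong (c *_) (G≋B i j) ⟩
  c * B i j   ∎

rows : ∀ {ℓ n k} → (Fin ℓ → Fin n) → Matrix n k → Matrix ℓ k
rows p A i j = A (p i) j

rows-orthogonal : ∀ {ℓ n k} (A : Matrix n k) (c : ℤ) (p : Fin ℓ → Fin n) →
  Injective _≡_ _≡_ p → A ⊗ A ᵀ ≋ c · I n → rows p A ⊗ (rows p A) ᵀ ≋ c · I ℓ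
rows-orthogonal A c p p-inj AAᵀ≋cI r s =
  trans (AAᵀ≋cI (p r) (p s)) (cong (c *_) (I-injective p p-inj r s))

permuted-prefix-injective : ∀ {ℓ n} (σ : Permutation′ n) (ℓ≤n : ℓ ≤ n) →
  Injective _≡_ _≡_ (λ i → σ ⟨$⟩ʳ inject≤ i ℓ≤n)
permuted-prefix-injective σ ℓ≤n {i} {j} σi≡σj = inject≤-injective ℓ≤n ℓ≤n i j
  (trans (sym (inverseˡ σ)) (trans (cong (σ ⟨$⟩ˡ_) σi≡σj) (inverseˡ σ)))

twoValued : ∀ n → ℤ → ℤ → Matrix n n
twoValued n d a = d · I n ⊕ a · (J n ⊖ I n)

diag-value : ∀ d a → d * 1ℤ + a * (1ℤ - 1ℤ) ≡ d
diag-value = solve-∀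

off-value : ∀ d a → d * 0ℤ + a * (1ℤ - 0ℤ) ≡ a
off-value = solve-∀

square-diag : ∀ m d a → let B = twoValued (suc (suc m)) d a in
  (B ⊗ B) zero zero ≡ d * d + (1ℤ + + m) * (a * a)
square-diag m d a = begin
  d′ * d′ + (a′ * a′ + sumFin m (λ _ → a′ * a′))
    ≡⟨ cong₂ (λ x y → x * x + (y * y + sumFin m (λ _ → y * y))) (diag-value d a) (off-value d a) ⟩
  d * d + (a * a + sumFin m (λ _ → a * a))
    ≡⟨ cong (λ s → d * d + (a * a + s)) (sum-const m (a * a)) ⟩
  d * d + (a * a + + m * (a * a))
    ≡⟨ collect d a (+ m) ⟩
  d * d + (1ℤ + + m) * (a * a) ∎
  where
  d′ = d * 1ℤ + a * (1ℤ - 1ℤ)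
  a′ = d * 0ℤ + a * (1ℤ - 0ℤ)
  collect : ∀ d a x → d * d + (a * a + x * (a * a)) ≡ d * d + (1ℤ + x) * (a * a)
  collect = solve-∀

square-off : ∀ m d a → let B = twoValued (suc (suc m)) d a in
  (B ⊗ B) zero (suc zero) ≡ d * a + a * d + + m * (a * a)
square-off m d a = begin
  d′ * a′ + (a′ * d′ + sumFin m (λ _ → a′ * a′))
    ≡⟨ cong₂ (λ x y → x * y + (y * x + sumFin m (λ _ → y * y))) (diag-value d a) (off-value d a) ⟩
  d * a + (a * d + sumFin m (λ _ → a * a))
    ≡⟨ cong (λ s → d * a + (a * d + s)) (sum-const m (a * a)) ⟩
  d * a + (a * d + + m * (a * a))
    ≡⟨ reassociate (d * a) (a * d) _ ⟩
  d * a + a * d + + m * (a * a) ∎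
  where
  d′ = d * 1ℤ + a * (1ℤ - 1ℤ)
  a′ = d * 0ℤ + a * (1ℤ - 0ℤ)
  reassociate : ∀ x y z → x + (y + z) ≡ x + y + z
  reassociate = solve-∀

quadratic-roots : ∀ x c → x * (x - c) ≡ 0ℤ → x ≡ 0ℤ ⊎ x ≡ c
quadratic-roots x c eq with i*j≡0⇒i≡0∨j≡0 x eq
... | inj₁ x≡0   = inj₁ x≡0
... | inj₂ x-c≡0 = inj₂ (i-j≡0⇒i≡j x c x-c≡0)

module TwoValuedSquare (m : ℕ) where

  M N : ℤ
  M = + m
  N = 1ℤ + (1ℤ + M)

  DiagEq OffEq : ℤ → ℤ → Set
  DiagEq d a = d * d + (1ℤ + M) * (a * a) ≡ N * d
  OffEq  d a = d * a + a * d + M * (a * a) ≡ N * a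

  square-law-equations : ∀ d a → let B = twoValued (suc (suc m)) d a in
    B ⊗ B ≋ N · B → DiagEq d a × OffEq d a
  square-law-equations d a B²≋nB = diagonal , off-diagonal
    where
    B : Matrix (suc (suc m)) (suc (suc m))
    B = twoValued (suc (suc m)) d a
    diagonal : DiagEq d a
    diagonal = begin
      d * d + (1ℤ + M) * (a * a) ≡⟨ sym (square-diag m d a) ⟩
      (B ⊗ B) zero zero          ≡⟨ B²≋nB zero zero ⟩
      N * B zero zero            ≡⟨ cong (N *_) (diag-value d a) ⟩
      N * d                      ∎
    off-diagonal : OffEq d a
    off-diagonal = begin
      d * a + a * d + M * (a * a) ≡⟨ sym (square-off m d a) ⟩
      (B ⊗ B) zero (suc zero)     ≡⟨ B²≋nB zero (suc zero) ⟩
      N * B zero (suc zero)       ≡⟨ cong (N *_) (off-value d a) ⟩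
      N * a                       ∎

  -- The difference of the two equations factors as (d − a)(d − a − n) = 0.
  gap-cases : ∀ d a → DiagEq d a → OffEq d a → d - a ≡ 0ℤ ⊎ d - a ≡ N
  gap-cases d a diag off = quadratic-roots (d - a) N (begin
    (d - a) * ((d - a) - N)
      ≡⟨ difference M d a ⟩
    (d * d + (1ℤ + M) * (a * a) - N * d) - (d * a + a * d + M * (a * a) - N * a)
      ≡⟨ cong₂ _-_ (i≡j⇒i-j≡0 diag) (i≡j⇒i-j≡0 off) ⟩
    0ℤ ∎)
    where
    difference : ∀ M d a → let N = 1ℤ + (1ℤ + M) in (d - a) * ((d - a) - N) ≡
      (d * d + (1ℤ + M) * (a * a) - N * d) - (d * a + a * d + M * (a * a) - N * a)
    difference = solve-∀

  cancel-N : ∀ y → N * y ≡ 0ℤ → y ≡ 0ℤ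
  cancel-N y Ny≡0 with i*j≡0⇒i≡0∨j≡0 N Ny≡0
  ... | inj₁ ()
  ... | inj₂ y≡0 = y≡0

  equal-case : ∀ a → OffEq a a → a ≡ 0ℤ ⊎ a ≡ 1ℤ
  equal-case a off = quadratic-roots a 1ℤ (cancel-N _ (begin
    N * (a * (a - 1ℤ))                           ≡⟨ expand M a ⟩
    a * a + a * a + M * (a * a) - N * a          ≡⟨ i≡j⇒i-j≡0 off ⟩
    0ℤ                                           ∎))
    where
    expand : ∀ M a → let N = 1ℤ + (1ℤ + M) in
      N * (a * (a - 1ℤ)) ≡ a * a + a * a + M * (a * a) - N * a
    expand = solve-∀

  shifted-case : ∀ a → OffEq (N + a) a → a ≡ 0ℤ ⊎ a ≡ - 1ℤ
  shifted-case a off = quadratic-roots a (- 1ℤ) (cancel-N _ (begin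
    N * (a * (a - - 1ℤ))                                     ≡⟨ expand M a ⟩
    (N + a) * a + a * (N + a) + M * (a * a) - N * a          ≡⟨ i≡j⇒i-j≡0 off ⟩
    0ℤ                                                       ∎))
    where
    expand : ∀ M a → let N = 1ℤ + (1ℤ + M) in
      N * (a * (a - - 1ℤ)) ≡ (N + a) * a + a * (N + a) + M * (a * a) - N * a
    expand = solve-∀

  gap-shift : ∀ d a → d - a ≡ N → d ≡ N + a
  gap-shift d a d-a≡N = trans (split d a) (cong (_+ a) d-a≡N)
    where
    split : ∀ d a → d ≡ (d - a) + a
    split = solve-∀

  solutions : ∀ d a → DiagEq d a → OffEq d a →
    (d ≡ a × (a ≡ 0ℤ ⊎ a ≡ 1ℤ)) ⊎ (d ≡ N + a × (a ≡ 0ℤ ⊎ a ≡ - 1ℤ))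
  solutions d a diag off with gap-cases d a diag off
  ... | inj₁ d-a≡0 with refl ← i-j≡0⇒i≡j d a d-a≡0 = inj₁ (refl , equal-case a off)
  ... | inj₂ d-a≡N with refl ← gap-shift d a d-a≡N = inj₂ (refl , shifted-case a off)

-- Translating the integer solutions back to ℓ ∈ ℕ; ℓ ≥ 1 excludes ℓ = a = 0.
classify : ∀ m ℓ a → 1 ≤ ℓ →
  (+ ℓ ≡ a × (a ≡ 0ℤ ⊎ a ≡ 1ℤ)) ⊎ (+ ℓ ≡ + suc (suc m) + a × (a ≡ 0ℤ ⊎ a ≡ - 1ℤ)) →
  ((ℓ ≡ 1) × (a ≡ 1ℤ)) ⊎ ((ℓ ≡ suc (suc m) ∸ 1) × (a ≡ - 1ℤ)) ⊎ ((ℓ ≡ suc (suc m)) × (a ≡ 0ℤ))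
classify m zero    a ()
classify m (suc ℓ) a _ (inj₁ (ℓ≡a , inj₁ refl)) with () ← ℓ≡a
classify m ℓ       a _ (inj₁ (ℓ≡a , inj₂ refl))   = inj₁ (+-injective ℓ≡a , refl)
classify m ℓ       a _ (inj₂ (ℓ≡n+a , inj₁ refl)) = inj₂ (inj₂ (+-injective (trans ℓ≡n+a (+-identityʳ _)) , refl))
classify m ℓ       a _ (inj₂ (ℓ≡n+a , inj₂ refl)) = inj₂ (inj₁ (+-injective ℓ≡n+a , refl))

proposition2p4 : (n ℓ : ℕ) (a : ℤ) (H : Matrix n n) (σ : Permutation′ n)
    → 2 ≤ n → 1 ≤ ℓ → (ℓ≤n : ℓ ≤ n)
    → IsHadamard n H
    → let H₁ : Matrix ℓ n
          H₁ = λ i j → H (σ ⟨$⟩ʳ inject≤ i ℓ≤n) j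
      in (H₁ ᵀ ⊗ H₁) ≋ ((+ ℓ) · I n ⊕ a · (J n ⊖ I n))
    → ((ℓ ≡ 1) × (a ≡ 1ℤ)) ⊎ ((ℓ ≡ n ∸ 1) × (a ≡ - 1ℤ)) ⊎ ((ℓ ≡ n) × (a ≡ 0ℤ))
proposition2p4 (suc (suc m)) ℓ a H σ (s≤s (s≤s z≤n)) 1≤ℓ ℓ≤n (_ , HHᵀ≋nI) G≋B =
  classify m ℓ a 1≤ℓ (uncurry (solutions (+ ℓ) a) equations)
  where
  open TwoValuedSquare m
  p : Fin ℓ → Fin (suc (suc m))
  p i = σ ⟨$⟩ʳ inject≤ i ℓ≤n
  G : Matrix (suc (suc m)) (suc (suc m))
  G = rows p H ᵀ ⊗ rows p H
  G²≋nG : G ⊗ G ≋ N · G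
  G²≋nG = gram-square (rows p H) N
    (rows-orthogonal H N p (permuted-prefix-injective σ ℓ≤n) HHᵀ≋nI)
  equations : DiagEq (+ ℓ) a × OffEq (+ ℓ) a
  equations = square-law-equations (+ ℓ) a (square-law-cong N G≋B G²≋nG)
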